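{- Let $c\ge 2$, $k\ge 1$ and $s\ge 1$ be integers, and suppose $G=\mathbb{Z}_c\times\mathbb{Z}_{ck}$ is $s$-regular. (1) If $c$ is even, then $|G|\le 2s^2$, and equality can occur only when $s\equiv 0 \pmod c$. (2) If $c$ is odd, then: if $s\equiv 0\pmod c$, then $|G|\le 2s^2+s$; if $s\equiv (c-1)/2\pmod c$, then $|G|\le 2s^2+2s-(c^2-1)/2$; if $c=3$ and $s\equiv 2\pmod 3$, then $|G|\le 2s^2+1$; and in all other cases $|G|<2s^2$.
   Context: $\mathbb{Z}_n=\mathbb{Z}/n\mathbb{Z}$. The group $\mathbb{Z}_c\times\mathbb{Z}_{ck}$ is called $s$-regular if there exist $u,v\in\mathbb{Z}_{ck}$ such that every element of the group equals $\lambda_1(1,u)+\lambda_2(1,v)$ for some integers $\lambda_1,\lambda_2$ with $|\lambda_1|+|\lambda_2|\le s$ (i.e. $\{(1,u),(1,v)\}$ is an $s$-spanning set). -}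

module Defs where

open import Data.Nat as ℕ using (ℕ; _≤_)
open import Data.Integer as ℤ using (ℤ; +_; _-_; ∣_∣)
open import Data.Integer.Divisibility using () renaming (_∣_ to _∣ℤ_)
open import Data.Fin using (Fin; toℕ)
open import Data.Product using (Σ; ∃; _×_; _,_)

_≡ℕ_[mod_] : ℕ → ℕ → ℕ → Set
a ≡ℕ b [mod n ] = (+ n) ∣ℤ ((+ a) - (+ b))

_≡ℤ_[mod_] : ℤ → ℤ → ℕ → Set
x ≡ℤ y [mod n ] = (+ n) ∣ℤ (x - y)

-- (λ₁, λ₂) represents the element (a, b) of ℤ_c × ℤ_{ck} with respect to
-- the generators (1,u), (1,v):  λ₁(1,u) + λ₂(1,v) = (a, b).
Represents : (c k : ℕ) → ℤ → ℤ → ℤ → ℤ → ℤ → ℤ → Set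
Represents c k u v a b λ₁ λ₂ =
  ((λ₁ ℤ.+ λ₂) ≡ℤ a [mod c ]) × (((λ₁ ℤ.* u) ℤ.+ (λ₂ ℤ.* v)) ≡ℤ b [mod (c ℕ.* k) ])

SRegular : (c k s : ℕ) → Set
SRegular c k s =
  Σ (Fin (c ℕ.* k)) λ u → Σ (Fin (c ℕ.* k)) λ v →
    (a : Fin c) → (b : Fin (c ℕ.* k)) →
      ∃ λ λ₁ → ∃ λ λ₂ → (∣ λ₁ ∣ ℕ.+ ∣ λ₂ ∣ ≤ s) ×
        Represents c k (+ toℕ u) (+ toℕ v) (+ toℕ a) (+ toℕ b) λ₁ λ₂

orderG : ℕ → ℕ → ℕ
orderG c k = c ℕ.* (c ℕ.* k)

-- Fix a ∈ ℤ_c. Each (a, b) is λ₁(1,u) + λ₂(1,v) with |λ₁| + |λ₂| ≤ s and λ₁ + λ₂ ≡ a (mod c), and distinct b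
-- need distinct pairs (λ₁, λ₂). In the rotated coordinates x = s + λ₁ + λ₂, y = s + λ₁ − λ₂ these pairs are
-- lattice points of [0, 2s]² with x ≡ y (mod 2) and x ≡ s + a (mod c), so they lie in the columns
-- x = e, e + c, e + 2c, … (e the residue of s + a); a column holds s points if x is odd and s + 1 if x is even.
-- Hence ck is at most the number of points in the columns up to 2s, and choosing the first column e well (any e
-- is s + a for some a) gives each bound. For even c, equality forces (2s/c)² = 2k, so 2s/c is even and c ∣ s.
module Submission where

open import Defs
open import Data.Nat using (ℕ; _+_; _*_; _∸_; _/_; _≤_; _<_)
open import Data.Nat.Divisibility using (_∣_)
open import Data.Product using (_×_)
open import Relation.Binary.PropositionalEquality using (_≡_)
open import Relation.Nullary using (¬_)

open import Data.Fin using (Fin; toℕ; fromℕ<)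
open import Data.Fin.Properties using (toℕ-fromℕ<; toℕ<n; toℕ-injective; injective⇒≤)
open import Data.Integer as ℤ using (ℤ; +_; -[1+_]; ∣_∣)
import Data.Integer.Properties as ℤ
open import Data.Integer.Divisibility.Signed using (∣ᵤ⇒∣; ∣⇒∣ᵤ; ∣m∣n⇒∣m+n) renaming (_∣_ to _∣ₛ_)
open import Data.Integer.Tactic.RingSolver as ℤ-Solver using ()
open import Data.Nat using (zero; suc; NonZero; >-nonZero; _%_; ∣_-_∣; z≤n; s≤s; s≤s⁻¹)
open import Data.Nat.DivMod
open import Data.Nat.Divisibility using (divides; m%n≡0⇒n∣m; n∣m⇒m%n≡0; *-monoˡ-∣)
open import Data.Nat.Primality using (euclidsLemma; prime[2])
open import Data.Nat.Properties
open import Data.Nat.Tactic.RingSolver as ℕ-Solver using ()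
open import Data.Product using (Σ; _,_; proj₁; proj₂; uncurry)
open import Data.Sum using (_⊎_; inj₁; inj₂; [_,_]′; reduce)
open import Function using (_∘_; id)
open import Relation.Binary.Definitions using (Tri; tri<; tri≈; tri>)
open import Relation.Binary.PropositionalEquality
  using (_≢_; refl; sym; trans; cong; cong₂; subst; subst₂; ≢-sym; module ≡-Reasoning)
open import Relation.Nullary using (contradiction)

m*n≤m*o+p∧p<m⇒n≤o : ∀ {m n o p} → m * n ≤ m * o + p → p < m → n ≤ o
m*n≤m*o+p∧p<m⇒n≤o {m} {n} {o} {p} mn≤mo+p p<m = s≤s⁻¹ (*-cancelˡ-< m n (suc o) (begin-strict
  m * n        ≤⟨ mn≤mo+p ⟩
  m * o + p    <⟨ +-monoʳ-< (m * o) p<m ⟩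
  m * o + m    ≡⟨ +-comm (m * o) m ⟩
  m + m * o    ≡⟨ *-suc m o ⟨
  m * suc o    ∎))
  where open ≤-Reasoning

m+o≤n+p∧p<o⇒m<n : ∀ {m n o p} → m + o ≤ n + p → p < o → m < n
m+o≤n+p∧p<o⇒m<n {m} {n} {o} {p} m+o≤n+p p<o = +-cancelʳ-< o m n (≤-<-trans m+o≤n+p (+-monoʳ-< n p<o))

%2≡0⊎%2≡1 : ∀ x → x % 2 ≡ 0 ⊎ x % 2 ≡ 1
%2≡0⊎%2≡1 x with x % 2 | m%n<n x 2
... | 0 | _ = inj₁ refl
... | 1 | _ = inj₂ refl
... | suc (suc _) | s≤s (s≤s ())

%-/-injective : ∀ {m n d} .{{_ : NonZero d}} → m % d ≡ n % d → m / d ≡ n / d → m ≡ n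
%-/-injective {m} {n} {d} m%d≡n%d m/d≡n/d = begin
  m                  ≡⟨ m≡m%n+[m/n]*n m d ⟩
  m % d + m / d * d  ≡⟨ cong₂ (λ r q → r + q * d) m%d≡n%d m/d≡n/d ⟩
  n % d + n / d * d  ≡⟨ m≡m%n+[m/n]*n n d ⟨
  n                  ∎
  where open ≡-Reasoning

+-%-surjective : ∀ {c} .{{_ : NonZero c}} s {e} → e < c → Σ (Fin c) λ a → (s + toℕ a) % c ≡ e
+-%-surjective {c@(suc c-1)} s {e} e<c = fromℕ< (m%n<n t c) , (begin
  (s + toℕ (fromℕ< (m%n<n t c))) % c  ≡⟨ cong (λ a → (s + a) % c) (toℕ-fromℕ< (m%n<n t c)) ⟩
  (s + t % c) % c                    ≡⟨ %-distribˡ-+ s (t % c) c ⟩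
  (s % c + t % c % c) % c            ≡⟨ cong (λ r → (s % c + r) % c) (m%n%n≡m%n t c) ⟩
  (s % c + t % c) % c                ≡⟨ %-distribˡ-+ s t c ⟨
  (s + t) % c                        ≡⟨ cong (_% c) (regroup s e c-1) ⟩
  (e + s * c) % c                    ≡⟨ [m+kn]%n≡m%n e s c ⟩
  e % c                              ≡⟨ m<n⇒m%n≡m e<c ⟩
  e                                  ∎)
  where
  open ≡-Reasoning
  t : ℕ
  t = e + c-1 * s
  regroup : ∀ s e c-1 → s + (e + c-1 * s) ≡ e + s * suc c-1
  regroup = ℕ-Solver.solve-∀

m%n≡r⇒m≡r+[m/n]*n : ∀ {m n r} .{{_ : NonZero n}} → m % n ≡ r → m ≡ r + m / n * n
m%n≡r⇒m≡r+[m/n]*n {m} {n} m%n≡r = trans (m≡m%n+[m/n]*n m n) (cong (_+ m / n * n) m%n≡r)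

∣+m-+n∣≡∣m-n∣ : ∀ m n → ∣ + m ℤ.- + n ∣ ≡ ∣ m - n ∣
∣+m-+n∣≡∣m-n∣ m n rewrite ℤ.m-n≡m⊖n m n with ≤-total m n
... | inj₁ m≤n = trans (ℤ.∣⊖∣-≤ m≤n) (sym (m≤n⇒∣m-n∣≡n∸m m≤n))
... | inj₂ n≤m = begin
  ∣ m ℤ.⊖ n ∣  ≡⟨ ℤ.∣m⊖n∣≡∣n⊖m∣ m n ⟩
  ∣ n ℤ.⊖ m ∣  ≡⟨ ℤ.∣⊖∣-≤ n≤m ⟩
  m ∸ n        ≡⟨ m≤n⇒∣m-n∣≡n∸m n≤m ⟨
  ∣ n - m ∣    ≡⟨ ∣-∣-comm n m ⟩
  ∣ m - n ∣    ∎
  where open ≡-Reasoning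

module _ {d : ℕ} .{{_ : NonZero d}} where

  private
    ∣∣m-n∣⇒%≡-≤ : ∀ {m n} → m ≤ n → d ∣ ∣ m - n ∣ → m % d ≡ n % d
    ∣∣m-n∣⇒%≡-≤ {m} {n} m≤n d∣ = begin
      m % d                ≡⟨ %-remove-+ʳ m (subst (d ∣_) (m≤n⇒∣m-n∣≡n∸m m≤n) d∣) ⟨
      (m + (n ∸ m)) % d    ≡⟨ cong (_% d) (m+[n∸m]≡n m≤n) ⟩
      n % d                ∎
      where open ≡-Reasoning

    %≡⇒∣∣m-n∣-≤ : ∀ {m n} → m ≤ n → m % d ≡ n % d → d ∣ ∣ m - n ∣
    %≡⇒∣∣m-n∣-≤ {m} {n} m≤n eq = divides (n / d ∸ m / d) (begin
      ∣ m - n ∣                                ≡⟨ m≤n⇒∣m-n∣≡n∸m m≤n ⟩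
      n ∸ m                                    ≡⟨ cong₂ _∸_ (m≡m%n+[m/n]*n n d) (m≡m%n+[m/n]*n m d) ⟩
      (n % d + n / d * d) ∸ (m % d + m / d * d) ≡⟨ cong (λ r → (r + n / d * d) ∸ (m % d + m / d * d)) (sym eq) ⟩
      (m % d + n / d * d) ∸ (m % d + m / d * d) ≡⟨ [m+n]∸[m+o]≡n∸o (m % d) (n / d * d) (m / d * d) ⟩
      n / d * d ∸ m / d * d                    ≡⟨ *-distribʳ-∸ d (n / d) (m / d) ⟨
      (n / d ∸ m / d) * d                      ∎)
      where open ≡-Reasoning

  ∣∣m-n∣⇒%≡ : ∀ m n → d ∣ ∣ m - n ∣ → m % d ≡ n % d
  ∣∣m-n∣⇒%≡ m n with ≤-total m n
  ... | inj₁ m≤n = ∣∣m-n∣⇒%≡-≤ m≤n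
  ... | inj₂ n≤m = sym ∘ ∣∣m-n∣⇒%≡-≤ n≤m ∘ subst (d ∣_) (∣-∣-comm m n)

  %≡⇒∣∣m-n∣ : ∀ m n → m % d ≡ n % d → d ∣ ∣ m - n ∣
  %≡⇒∣∣m-n∣ m n with ≤-total m n
  ... | inj₁ m≤n = %≡⇒∣∣m-n∣-≤ m≤n
  ... | inj₂ n≤m = subst (d ∣_) (∣-∣-comm n m) ∘ %≡⇒∣∣m-n∣-≤ n≤m ∘ sym

  -- Divisibility in ℤ is divisibility of absolute values, so m ≡ℕ n [mod d ] unfolds to d ∣ ∣ + m ℤ.- + n ∣.
  ≡[mod]⇒%≡ : ∀ {m n} → m ≡ℕ n [mod d ] → m % d ≡ n % d
  ≡[mod]⇒%≡ {m} {n} = ∣∣m-n∣⇒%≡ m n ∘ subst (d ∣_) (∣+m-+n∣≡∣m-n∣ m n)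

  %≡⇒≡[mod] : ∀ {m n} → m % d ≡ n % d → m ≡ℕ n [mod d ]
  %≡⇒≡[mod] {m} {n} = subst (d ∣_) (sym (∣+m-+n∣≡∣m-n∣ m n)) ∘ %≡⇒∣∣m-n∣ m n

module _ {n : ℕ} where

  ≡ℤ-sym : ∀ {x y} → x ≡ℤ y [mod n ] → y ≡ℤ x [mod n ]
  ≡ℤ-sym {x} {y} = subst (n ∣_) (ℤ.∣i-j∣≡∣j-i∣ x y)

  ≡ℤ-trans : ∀ {x y z} → x ≡ℤ y [mod n ] → y ≡ℤ z [mod n ] → x ≡ℤ z [mod n ]
  ≡ℤ-trans {x} {y} {z} p q =
    ∣⇒∣ᵤ (subst ((+ n) ∣ₛ_) (telescope x y z) (∣m∣n⇒∣m+n (∣ᵤ⇒∣ {i = x ℤ.- y} p) (∣ᵤ⇒∣ {i = y ℤ.- z} q)))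
    where
    telescope : ∀ x y z → (x ℤ.- y) ℤ.+ (y ℤ.- z) ≡ x ℤ.- z
    telescope = ℤ-Solver.solve-∀

  ≡ℤ-+ˡ : ∀ w {x y} → x ≡ℤ y [mod n ] → (w ℤ.+ x) ≡ℤ (w ℤ.+ y) [mod n ]
  ≡ℤ-+ˡ w {x} {y} = subst (n ∣_) (cong ∣_∣ (cancel w x y))
    where
    cancel : ∀ w x y → x ℤ.- y ≡ (w ℤ.+ x) ℤ.- (w ℤ.+ y)
    cancel = ℤ-Solver.solve-∀

≡[mod]⇒≡ : ∀ {m n d} → m < d → n < d → m ≡ℕ n [mod d ] → m ≡ n
≡[mod]⇒≡ {m} {n} {d@(suc _)} m<d n<d m≡n = begin
  m      ≡⟨ m<n⇒m%n≡m m<d ⟨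
  m % d  ≡⟨ ≡[mod]⇒%≡ {m = m} {n} m≡n ⟩
  n % d  ≡⟨ m<n⇒m%n≡m n<d ⟩
  n      ∎
  where open ≡-Reasoning

≡[mod]∧<⇒%≡ : ∀ {m r d} .{{_ : NonZero d}} → r < d → m ≡ℕ r [mod d ] → m % d ≡ r
≡[mod]∧<⇒%≡ {m} r<d m≡r = trans (≡[mod]⇒%≡ {m = m} m≡r) (m<n⇒m%n≡m r<d)

%≡∧<⇒≡[mod] : ∀ {m r d} .{{_ : NonZero d}} → r < d → m % d ≡ r → m ≡ℕ r [mod d ]
%≡∧<⇒≡[mod] {m} r<d m%d≡r = %≡⇒≡[mod] {m = m} (trans m%d≡r (sym (m<n⇒m%n≡m r<d)))

sumBelow : (ℕ → ℕ) → ℕ → ℕ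
sumBelow w zero    = 0
sumBelow w (suc n) = sumBelow w n + w n

module _ (w : ℕ → ℕ) where

  sumBelow-mono-≤ : ∀ {i j} → i ≤ j → sumBelow w i ≤ sumBelow w j
  sumBelow-mono-≤ {j = zero}  z≤n = ≤-refl
  sumBelow-mono-≤ {j = suc j} i≤1+j with m≤n⇒m<n∨m≡n i≤1+j
  ... | inj₁ i<1+j = ≤-trans (sumBelow-mono-≤ (s≤s⁻¹ i<1+j)) (m≤m+n _ (w j))
  ... | inj₂ refl  = ≤-refl

  sumBelow+<sumBelow : ∀ {j j' h} h' → h < w j → j < j' → sumBelow w j + h < sumBelow w j' + h'
  sumBelow+<sumBelow {j} h' h<w j<j' =
    ≤-trans (+-monoʳ-< (sumBelow w j) h<w) (≤-trans (sumBelow-mono-≤ j<j') (m≤m+n _ h'))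

  sumBelow+-injective : ∀ {j j' h h'} → h < w j → h' < w j' →
                        sumBelow w j + h ≡ sumBelow w j' + h' → j ≡ j' × h ≡ h'
  sumBelow+-injective {j} {j'} {h} {h'} h<w h'<w eq with <-cmp j j'
  ... | tri< j<j' _ _ = contradiction eq (<⇒≢ (sumBelow+<sumBelow h' h<w j<j'))
  ... | tri> _ _ j'<j = contradiction eq (≢-sym (<⇒≢ (sumBelow+<sumBelow h h'<w j'<j)))
  ... | tri≈ _ refl _ = refl , +-cancelˡ-≡ (sumBelow w j) h h' eq

  injection⇒≤sumBelow : ∀ {m n} (j h : Fin m → ℕ) → (∀ b → j b < n) → (∀ b → h b < w (j b)) →
                        (∀ {b b'} → j b ≡ j b' → h b ≡ h b' → b ≡ b') → m ≤ sumBelow w n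
  injection⇒≤sumBelow {m} {n} j h j<n h<w inj = injective⇒≤ code-injective
    where
    code<sum : ∀ b → sumBelow w (j b) + h b < sumBelow w n
    code<sum b = ≤-trans (+-monoʳ-< (sumBelow w (j b)) (h<w b)) (sumBelow-mono-≤ (j<n b))

    code : Fin m → Fin (sumBelow w n)
    code b = fromℕ< (code<sum b)

    code-injective : ∀ {b b'} → code b ≡ code b' → b ≡ b'
    code-injective {b} {b'} eq = uncurry inj (sumBelow+-injective (h<w b) (h<w b') (begin
      sumBelow w (j b) + h b    ≡⟨ toℕ-fromℕ< (code<sum b) ⟨
      toℕ (code b)              ≡⟨ cong toℕ eq ⟩
      toℕ (code b')             ≡⟨ toℕ-fromℕ< (code<sum b') ⟩
      sumBelow w (j b') + h b'  ∎))
      where open ≡-Reasoning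

  sumBelow-const : ∀ {a} → (∀ j → w j ≡ a) → ∀ n → sumBelow w n ≡ n * a
  sumBelow-const {a} w≡a zero    = refl
  sumBelow-const {a} w≡a (suc n) = begin
    sumBelow w n + w n  ≡⟨ cong₂ _+_ (sumBelow-const w≡a n) (w≡a n) ⟩
    n * a + a           ≡⟨ +-comm (n * a) a ⟩
    suc n * a           ∎
    where open ≡-Reasoning

  sumBelow-pairs : ∀ {a} → (∀ j → w j + w (suc j) ≡ a) → ∀ q → sumBelow w (q * 2) ≡ q * a
  sumBelow-pairs {a} pair≡a zero    = refl
  sumBelow-pairs {a} pair≡a (suc q) = begin
    sumBelow w (q * 2) + w (q * 2) + w (suc (q * 2))    ≡⟨ +-assoc (sumBelow w (q * 2)) _ _ ⟩
    sumBelow w (q * 2) + (w (q * 2) + w (suc (q * 2)))  ≡⟨ cong₂ _+_ (sumBelow-pairs pair≡a q) (pair≡a (q * 2)) ⟩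
    q * a + a                                           ≡⟨ +-comm (q * a) a ⟩
    suc q * a                                           ∎
    where open ≡-Reasoning

-- The number of y ≤ 2 * s with y ≡ x (mod 2).
sameParityCount : ℕ → ℕ → ℕ
sameParityCount s x = s + (1 ∸ x % 2)

module _ (s : ℕ) where

  sameParityCount-even : ∀ x → x % 2 ≡ 0 → sameParityCount s x ≡ suc s
  sameParityCount-even x x%2≡0 rewrite x%2≡0 = +-comm s 1

  sameParityCount-odd : ∀ x → x % 2 ≡ 1 → sameParityCount s x ≡ s
  sameParityCount-odd x x%2≡1 rewrite x%2≡1 = +-identityʳ s

  sameParityCount-+*2 : ∀ x k → sameParityCount s (x + k * 2) ≡ sameParityCount s x
  sameParityCount-+*2 x k = cong (λ r → s + (1 ∸ r)) ([m+kn]%n≡m%n x k 2)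

  sameParityCount-+odd : ∀ {c} x → c % 2 ≡ 1 → sameParityCount s x + sameParityCount s (x + c) ≡ suc (2 * s)
  sameParityCount-+odd {c} x c%2≡1 with %2≡0⊎%2≡1 x
  ... | inj₁ x%2≡0 = begin
    sameParityCount s x + sameParityCount s (x + c)
      ≡⟨ cong₂ _+_ (sameParityCount-even x x%2≡0) (sameParityCount-odd (x + c) [x+c]%2≡1) ⟩
    suc s + s
      ≡⟨ cong suc (cong (_+_ s) (+-identityʳ s)) ⟨
    suc (2 * s)
      ∎
    where
    open ≡-Reasoning
    [x+c]%2≡1 : (x + c) % 2 ≡ 1
    [x+c]%2≡1 = trans (%-distribˡ-+ x c 2) (cong₂ (λ a b → (a + b) % 2) x%2≡0 c%2≡1)
  ... | inj₂ x%2≡1 = begin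
    sameParityCount s x + sameParityCount s (x + c)
      ≡⟨ cong₂ _+_ (sameParityCount-odd x x%2≡1) (sameParityCount-even (x + c) [x+c]%2≡0) ⟩
    s + suc s
      ≡⟨ +-suc s s ⟩
    suc (s + s)
      ≡⟨ cong suc (cong (_+_ s) (+-identityʳ s)) ⟨
    suc (2 * s)
      ∎
    where
    open ≡-Reasoning
    [x+c]%2≡0 : (x + c) % 2 ≡ 0
    [x+c]%2≡0 = trans (%-distribˡ-+ x c 2) (cong₂ (λ a b → (a + b) % 2) x%2≡1 c%2≡1)

  /2<sameParityCount : ∀ {x y} → y ≤ 2 * s → y % 2 ≡ x % 2 → y / 2 < sameParityCount s x
  /2<sameParityCount {x} {y} y≤2s y%2≡x%2 with %2≡0⊎%2≡1 x
  ... | inj₁ x%2≡0 = subst (y / 2 <_) (sym (sameParityCount-even x x%2≡0)) (s≤s (*-cancelʳ-≤ (y / 2) s 2 (begin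
    y / 2 * 2           ≡⟨ cong (_+ y / 2 * 2) (trans y%2≡x%2 x%2≡0) ⟨
    y % 2 + y / 2 * 2   ≡⟨ m≡m%n+[m/n]*n y 2 ⟨
    y                   ≤⟨ y≤2s ⟩
    2 * s               ≡⟨ *-comm 2 s ⟩
    s * 2               ∎)))
    where open ≤-Reasoning
  ... | inj₂ x%2≡1 = subst (y / 2 <_) (sym (sameParityCount-odd x x%2≡1)) (*-cancelʳ-< 2 (y / 2) s (begin-strict
    y / 2 * 2           <⟨ n<1+n (y / 2 * 2) ⟩
    1 + y / 2 * 2       ≡⟨ cong (_+ y / 2 * 2) (trans y%2≡x%2 x%2≡1) ⟨
    y % 2 + y / 2 * 2   ≡⟨ m≡m%n+[m/n]*n y 2 ⟨
    y                   ≤⟨ y≤2s ⟩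
    2 * s               ≡⟨ *-comm 2 s ⟩
    s * 2               ∎))
    where open ≤-Reasoning

∣i∣≤s⇒0≤s+i≤2s : ∀ {s} i → ∣ i ∣ ≤ s → Σ ℕ λ x → + x ≡ + s ℤ.+ i × x ≤ 2 * s
∣i∣≤s⇒0≤s+i≤2s {s} (+ n)     n≤s    = s + n , refl , +-monoʳ-≤ s (≤-trans n≤s (m≤m+n s 0))
∣i∣≤s⇒0≤s+i≤2s {s} -[1+ n ]  1+n≤s  = s ∸ suc n , sym (ℤ.⊖-≥ 1+n≤s) , ≤-trans (m∸n≤m s (suc n)) (m≤m+n s (s + 0))

record Rotated (s : ℕ) (λ₁ λ₂ : ℤ) : Set where
  field
    x y : ℕ
    x≡ : + x ≡ + s ℤ.+ (λ₁ ℤ.+ λ₂)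
    y≡ : + y ≡ + s ℤ.+ (λ₁ ℤ.- λ₂)
    x≤ : x ≤ 2 * s
    y≤ : y ≤ 2 * s

  x-y≡λ₂*2 : + x ℤ.- + y ≡ λ₂ ℤ.* + 2
  x-y≡λ₂*2 = trans (cong₂ ℤ._-_ x≡ y≡) (difference (+ s) λ₁ λ₂)
    where
    difference : ∀ s a b → (s ℤ.+ (a ℤ.+ b)) ℤ.- (s ℤ.+ (a ℤ.- b)) ≡ b ℤ.* + 2
    difference = ℤ-Solver.solve-∀

  x+y-2s≡λ₁*2 : (+ x ℤ.+ + y) ℤ.- (+ s ℤ.+ + s) ≡ λ₁ ℤ.* + 2
  x+y-2s≡λ₁*2 = trans (cong (λ t → t ℤ.- (+ s ℤ.+ + s)) (cong₂ ℤ._+_ x≡ y≡)) (sum (+ s) λ₁ λ₂)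
    where
    sum : ∀ s a b → ((s ℤ.+ (a ℤ.+ b)) ℤ.+ (s ℤ.+ (a ℤ.- b))) ℤ.- (s ℤ.+ s) ≡ a ℤ.* + 2
    sum = ℤ-Solver.solve-∀

  x%2≡y%2 : x % 2 ≡ y % 2
  x%2≡y%2 = ≡[mod]⇒%≡ {m = x} {y} (divides ∣ λ₂ ∣ (trans (cong ∣_∣ x-y≡λ₂*2) (ℤ.abs-* λ₂ (+ 2))))

rotate : ∀ {s} λ₁ λ₂ → ∣ λ₁ ∣ + ∣ λ₂ ∣ ≤ s → Rotated s λ₁ λ₂
rotate {s} λ₁ λ₂ ∣λ∣≤s = record
  { x = proj₁ shifted-sum ; x≡ = proj₁ (proj₂ shifted-sum) ; x≤ = proj₂ (proj₂ shifted-sum)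
  ; y = proj₁ shifted-difference ; y≡ = proj₁ (proj₂ shifted-difference) ; y≤ = proj₂ (proj₂ shifted-difference)
  }
  where
  shifted-sum : Σ ℕ λ x → + x ≡ + s ℤ.+ (λ₁ ℤ.+ λ₂) × x ≤ 2 * s
  shifted-sum = ∣i∣≤s⇒0≤s+i≤2s (λ₁ ℤ.+ λ₂) (≤-trans (ℤ.∣i+j∣≤∣i∣+∣j∣ λ₁ λ₂) ∣λ∣≤s)

  shifted-difference : Σ ℕ λ y → + y ≡ + s ℤ.+ (λ₁ ℤ.- λ₂) × y ≤ 2 * s
  shifted-difference = ∣i∣≤s⇒0≤s+i≤2s (λ₁ ℤ.- λ₂) (≤-trans (ℤ.∣i-j∣≤∣i∣+∣j∣ λ₁ λ₂) ∣λ∣≤s)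

Rotated-injective : ∀ {s λ₁ λ₂ λ₁' λ₂'} (p : Rotated s λ₁ λ₂) (p' : Rotated s λ₁' λ₂') →
                    Rotated.x p ≡ Rotated.x p' → Rotated.y p ≡ Rotated.y p' → λ₁ ≡ λ₁' × λ₂ ≡ λ₂'
Rotated-injective {s} {λ₁} {λ₂} {λ₁'} {λ₂'} p p' x≡x' y≡y' =
  ℤ.*-cancelʳ-≡ _ _ (+ 2) (begin
    λ₁ ℤ.* + 2                          ≡⟨ Rotated.x+y-2s≡λ₁*2 p ⟨
    (+ x ℤ.+ + y) ℤ.- (+ s ℤ.+ + s)     ≡⟨ cong₂ (λ a b → (+ a ℤ.+ + b) ℤ.- (+ s ℤ.+ + s)) x≡x' y≡y' ⟩
    (+ x' ℤ.+ + y') ℤ.- (+ s ℤ.+ + s)   ≡⟨ Rotated.x+y-2s≡λ₁*2 p' ⟩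
    λ₁' ℤ.* + 2                         ∎) ,
  ℤ.*-cancelʳ-≡ _ _ (+ 2) (begin
    λ₂ ℤ.* + 2              ≡⟨ Rotated.x-y≡λ₂*2 p ⟨
    + x ℤ.- + y             ≡⟨ cong₂ (λ a b → + a ℤ.- + b) x≡x' y≡y' ⟩
    + x' ℤ.- + y'           ≡⟨ Rotated.x-y≡λ₂*2 p' ⟩
    λ₂' ℤ.* + 2             ∎)
  where
  open ≡-Reasoning
  open Rotated p using (x; y)
  open Rotated p' using () renaming (x to x'; y to y')

-- The points of [0, 2s]² with x ≡ y (mod 2) in the columns x = e + j c, j < n.
latticeCount : (s c e n : ℕ) → ℕ
latticeCount s c e n = sumBelow (λ j → sameParityCount s (e + j * c)) n

regular⇒≤latticeCount : ∀ {c k s} .{{_ : NonZero c}} → SRegular c k s →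
                        ∀ e n → e < c → 2 * s < e + n * c → c * k ≤ latticeCount s c e n
regular⇒≤latticeCount {c} {k} {s} (u , v , represent) e n e<c 2s<e+nc =
  injection⇒≤sumBelow _ j h j<n h<count injective
  where
  a : Fin c
  a = proj₁ (+-%-surjective s e<c)

  module _ (b : Fin (c * k)) where
    λ₁ λ₂ : ℤ
    λ₁ = proj₁ (represent a b)
    λ₂ = proj₁ (proj₂ (represent a b))

    point : Rotated s λ₁ λ₂
    point = rotate λ₁ λ₂ (proj₁ (proj₂ (proj₂ (represent a b))))

    sum≡a : (λ₁ ℤ.+ λ₂) ≡ℤ + toℕ a [mod c ]
    sum≡a = proj₁ (proj₂ (proj₂ (proj₂ (represent a b))))

    combination : ℤ
    combination = (λ₁ ℤ.* + toℕ u) ℤ.+ (λ₂ ℤ.* + toℕ v)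

    combination≡b : combination ≡ℤ + toℕ b [mod c * k ]
    combination≡b = proj₂ (proj₂ (proj₂ (proj₂ (represent a b))))

    open Rotated point public using (x; y)

    x≡s+a : x ≡ℕ (s + toℕ a) [mod c ]
    x≡s+a = subst (_≡ℤ + (s + toℕ a) [mod c ]) (sym (Rotated.x≡ point)) (≡ℤ-+ˡ (+ s) {λ₁ ℤ.+ λ₂} sum≡a)

    x%c≡e : x % c ≡ e
    x%c≡e = trans (≡[mod]⇒%≡ {m = x} x≡s+a) (proj₂ (+-%-surjective s e<c))

    j h : ℕ
    j = x / c
    h = y / 2

    x≡e+jc : x ≡ e + j * c
    x≡e+jc = trans (m≡m%n+[m/n]*n x c) (cong (_+ j * c) x%c≡e)

    j<n : j < n
    j<n = *-cancelʳ-< c j n (+-cancelˡ-< e (j * c) (n * c)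
            (≤-<-trans (≤-reflexive (sym x≡e+jc)) (≤-<-trans (Rotated.x≤ point) 2s<e+nc)))

    h<count : h < sameParityCount s (e + j * c)
    h<count = /2<sameParityCount s {e + j * c} (Rotated.y≤ point)
                (trans (sym (Rotated.x%2≡y%2 point)) (cong (_% 2) x≡e+jc))

  injective : ∀ {b b'} → j b ≡ j b' → h b ≡ h b' → b ≡ b'
  injective {b} {b'} jb≡jb' hb≡hb' = toℕ-injective (≡[mod]⇒≡ (toℕ<n b) (toℕ<n b') b≡b')
    where
    xb≡xb' : x b ≡ x b'
    xb≡xb' = trans (x≡e+jc b) (trans (cong (λ i → e + i * c) jb≡jb') (sym (x≡e+jc b')))

    yb≡yb' : y b ≡ y b'
    yb≡yb' = %-/-injective (trans (sym (Rotated.x%2≡y%2 (point b)))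
                                  (trans (cong (_% 2) xb≡xb') (Rotated.x%2≡y%2 (point b')))) hb≡hb'

    same-combination : combination b ≡ combination b'
    same-combination = uncurry (cong₂ (λ p q → (p ℤ.* + toℕ u) ℤ.+ (q ℤ.* + toℕ v)))
                               (Rotated-injective (point b) (point b') xb≡xb' yb≡yb')

    b≡b' : toℕ b ≡ℕ toℕ b' [mod c * k ]
    b≡b' = ≡ℤ-trans {x = + toℕ b} {y = combination b} (≡ℤ-sym {x = combination b} (combination≡b b))
             (subst (_≡ℤ + toℕ b' [mod c * k ]) (sym same-combination) (combination≡b b'))

module _ (s : ℕ) where

  latticeCount-evenModulus : ∀ m e → e % 2 ≡ 1 → ∀ n → latticeCount s (m * 2) e n ≡ n * s
  latticeCount-evenModulus m e e%2≡1 = sumBelow-const _ λ j → begin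
    sameParityCount s (e + j * (m * 2))  ≡⟨ cong (λ t → sameParityCount s (e + t)) (*-assoc j m 2) ⟨
    sameParityCount s (e + j * m * 2)    ≡⟨ sameParityCount-+*2 s e (j * m) ⟩
    sameParityCount s e                  ≡⟨ sameParityCount-odd s e e%2≡1 ⟩
    s                                    ∎
    where open ≡-Reasoning

  module _ {c : ℕ} (c%2≡1 : c % 2 ≡ 1) (e : ℕ) where

    latticeCount-oddModulus-even : ∀ q → latticeCount s c e (q * 2) ≡ q * suc (2 * s)
    latticeCount-oddModulus-even = sumBelow-pairs _ λ j → begin
      sameParityCount s (e + j * c) + sameParityCount s (e + suc j * c)
        ≡⟨ cong (_+_ (sameParityCount s (e + j * c)) ∘ sameParityCount s) (next-term e j) ⟩
      sameParityCount s (e + j * c) + sameParityCount s (e + j * c + c)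
        ≡⟨ sameParityCount-+odd s (e + j * c) c%2≡1 ⟩
      suc (2 * s)
        ∎
      where
      open ≡-Reasoning
      next-term : ∀ e j → e + suc j * c ≡ e + j * c + c
      next-term e j = trans (cong (_+_ e) (+-comm c (j * c))) (sym (+-assoc e (j * c) c))

    latticeCount-oddModulus-odd : ∀ q → latticeCount s c e (suc (q * 2)) ≡ q * suc (2 * s) + sameParityCount s e
    latticeCount-oddModulus-odd q = cong₂ _+_ (latticeCount-oddModulus-even q) (begin
      sameParityCount s (e + q * 2 * c)    ≡⟨ cong (λ t → sameParityCount s (e + t)) (swap q c) ⟩
      sameParityCount s (e + q * c * 2)    ≡⟨ sameParityCount-+*2 s e (q * c) ⟩
      sameParityCount s e                  ∎)
      where
      open ≡-Reasoning
      swap : ∀ q c → q * 2 * c ≡ q * c * 2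
      swap = ℕ-Solver.solve-∀

-- With c = 2M, the columns x ≡ c − 1 (mod c) are odd, so each holds s points, and ⌊s / M⌋ of them reach past 2s.
module EvenModulus (m k s : ℕ) (regular : SRegular (suc m * 2) k s) where

  private
    M c n : ℕ
    M = suc m
    c = M * 2
    n = s / M

    2s<c-1+nc : 2 * s < suc (m * 2) + n * c
    2s<c-1+nc = begin-strict
      2 * s                  ≡⟨ cong (2 *_) (m≡m%n+[m/n]*n s M) ⟩
      2 * (s % M + n * M)    ≡⟨ regroup (s % M) n M ⟩
      s % M * 2 + n * c      ≤⟨ +-monoˡ-≤ (n * c) (*-monoˡ-≤ 2 (s≤s⁻¹ (m%n<n s M))) ⟩
      m * 2 + n * c          <⟨ n<1+n (m * 2 + n * c) ⟩
      suc (m * 2) + n * c    ∎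
      where
      open ≤-Reasoning
      regroup : ∀ r n M → 2 * (r + n * M) ≡ r * 2 + n * (M * 2)
      regroup = ℕ-Solver.solve-∀

    ck≤ns : c * k ≤ n * s
    ck≤ns = ≤-trans (regular⇒≤latticeCount {k = k} regular (suc (m * 2)) n (n<1+n (suc (m * 2))) 2s<c-1+nc)
                    (≤-reflexive (latticeCount-evenModulus s M (suc (m * 2)) ([m+kn]%n≡m%n 1 m 2) n))

    c[ns]≡2[nM*s] : c * (n * s) ≡ 2 * (n * M * s)
    c[ns]≡2[nM*s] = shape n M s
      where
      shape : ∀ n M s → M * 2 * (n * s) ≡ 2 * (n * M * s)
      shape = ℕ-Solver.solve-∀

    orderG≤c[ns] : orderG c k ≤ c * (n * s)
    orderG≤c[ns] = *-monoʳ-≤ c ck≤ns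

    c[ns]≤2s² : c * (n * s) ≤ 2 * (s * s)
    c[ns]≤2s² = ≤-trans (≤-reflexive c[ns]≡2[nM*s]) (*-monoʳ-≤ 2 (*-monoˡ-≤ s (m/n*n≤m s M)))

  bound : orderG c k ≤ 2 * (s * s)
  bound = ≤-trans orderG≤c[ns] c[ns]≤2s²

  extremal : 1 ≤ s → orderG c k ≡ 2 * (s * s) → s ≡ℕ 0 [mod c ]
  extremal 1≤s orderG≡2s² = %≡⇒≡[mod] {m = s} {0} (n∣m⇒m%n≡0 s c c∣s)
    where
    tight : c * (n * s) ≡ 2 * (s * s)
    tight = ≤-antisym c[ns]≤2s² (subst (_≤ c * (n * s)) orderG≡2s² orderG≤c[ns])

    nM≡s : n * M ≡ s
    nM≡s = *-cancelʳ-≡ (n * M) s s {{>-nonZero 1≤s}}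
             (*-cancelˡ-≡ (n * M * s) (s * s) 2 (trans (sym c[ns]≡2[nM*s]) tight))

    k*2≡n*n : k * 2 ≡ n * n
    k*2≡n*n = *-cancelʳ-≡ (k * 2) (n * n) M (begin
      k * 2 * M      ≡⟨ shape k M ⟩
      c * k          ≡⟨ *-cancelˡ-≡ (c * k) (n * s) c (trans orderG≡2s² (sym tight)) ⟩
      n * s          ≡⟨ cong (_*_ n) nM≡s ⟨
      n * (n * M)    ≡⟨ *-assoc n n M ⟨
      n * n * M      ∎)
      where
      open ≡-Reasoning
      shape : ∀ k M → k * 2 * M ≡ M * 2 * k
      shape = ℕ-Solver.solve-∀

    2∣n : 2 ∣ n
    2∣n = reduce (euclidsLemma n n prime[2] (divides k (sym k*2≡n*n)))

    c∣s : c ∣ s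
    c∣s = subst₂ _∣_ (*-comm 2 M) nM≡s (*-monoˡ-∣ M 2∣n)

-- Write c = 2h + 1 and s = r + q c with r < c. The first column e is 2r + 1 when r < h, 2(r − h) + 1 when
-- h ≤ r < 2h and 2h when r = 2h: odd whenever possible, as an odd column holds s points and an even one s + 1,
-- while any two consecutive columns together hold 2s + 1.
module OddModulus (h k : ℕ) where

  c : ℕ
  c = suc (h * 2)

  private
    c%2≡1 : c % 2 ≡ 1
    c%2≡1 = [m+kn]%n≡m%n 1 h 2

    1+2t<c : ∀ {t} → t < h → suc (t * 2) < c
    1+2t<c t<h = s≤s (*-monoˡ-< 2 t<h)

    count-2q : ∀ {s} → SRegular c k s → ∀ e q → e < c → 2 * s < e + q * 2 * c →
               c * k ≤ q * suc (2 * s)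
    count-2q {s} regular e q e<c 2s<e+nc = ≤-trans
      (regular⇒≤latticeCount {k = k} regular e (q * 2) e<c 2s<e+nc)
      (≤-reflexive (latticeCount-oddModulus-even s c%2≡1 e q))

    count-1+2q : ∀ {s} → SRegular c k s → ∀ e q → e < c → 2 * s < e + suc (q * 2) * c →
                 c * k ≤ q * suc (2 * s) + sameParityCount s e
    count-1+2q {s} regular e q e<c 2s<e+nc = ≤-trans
      (regular⇒≤latticeCount {k = k} regular e (suc (q * 2)) e<c 2s<e+nc)
      (≤-reflexive (latticeCount-oddModulus-odd s c%2≡1 e q))

    count-h≤r<2h : ∀ {s t q} → t < h → s ≡ h + t + q * c → SRegular c k s → c * k ≤ q * suc (2 * s) + s
    count-h≤r<2h {s} {t} {q} t<h refl regular = ≤-trans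
      (count-1+2q regular (suc (t * 2)) q (1+2t<c t<h) (≤-trans (n≤1+n _) (≤-reflexive (span h t q))))
      (≤-reflexive (cong (_+_ (q * suc (2 * s))) (sameParityCount-odd s (suc (t * 2)) ([m+kn]%n≡m%n 1 t 2))))
      where
      span : ∀ h t q → suc (suc (2 * (h + t + q * suc (h * 2)))) ≡ suc (t * 2) + suc (q * 2) * suc (h * 2)
      span = ℕ-Solver.solve-∀

  bound-r<h : ∀ {s t q} → t < h → s ≡ t + q * c → SRegular c k s →
              orderG c k + t * suc (2 * s) ≤ 2 * (s * s) + s
  bound-r<h {s} {t} {q} t<h refl regular = begin
    c * (c * k) + t * suc (2 * s)            ≤⟨ +-monoˡ-≤ (t * suc (2 * s)) (*-monoʳ-≤ c ck≤q[1+2s]) ⟩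
    c * (q * suc (2 * s)) + t * suc (2 * s)  ≡⟨ total t q h ⟩
    2 * (s * s) + s                          ∎
    where
    open ≤-Reasoning
    span : ∀ t q h → 2 * (t + q * suc (h * 2)) ≡ t * 2 + q * 2 * suc (h * 2)
    span = ℕ-Solver.solve-∀
    ck≤q[1+2s] : c * k ≤ q * suc (2 * s)
    ck≤q[1+2s] = count-2q regular (suc (t * 2)) q (1+2t<c t<h) (≤-reflexive (cong suc (span t q h)))
    total : ∀ t q h → let s = t + q * suc (h * 2) in
            suc (h * 2) * (q * suc (2 * s)) + t * suc (2 * s) ≡ 2 * (s * s) + s
    total = ℕ-Solver.solve-∀

  bound-h≤r<2h : ∀ {s t q} → t < h → s ≡ h + t + q * c → SRegular c k s →
                 orderG c k + (2 * t * s + (h + t)) ≤ 2 * (s * s) + 2 * s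
  bound-h≤r<2h {s} {t} {q} t<h refl regular = begin
    c * (c * k) + (2 * t * s + (h + t))
      ≤⟨ +-monoˡ-≤ _ (*-monoʳ-≤ c (count-h≤r<2h {q = q} t<h refl regular)) ⟩
    c * (q * suc (2 * s) + s) + (2 * t * s + (h + t))
      ≡⟨ total h t q ⟩
    2 * (s * s) + 2 * s
      ∎
    where
    open ≤-Reasoning
    total : ∀ h t q → let s = h + t + q * suc (h * 2) in
            suc (h * 2) * (q * suc (2 * s) + s) + (2 * t * s + (h + t)) ≡ 2 * (s * s) + 2 * s
    total = ℕ-Solver.solve-∀

  -- Rounding c * k ≤ c * K + h down to k ≤ K (as h < c) is what gains the term (c² − 1) / 2.
  bound-r≡h : ∀ {s q} → 1 ≤ h → s ≡ h + q * c → SRegular c k s →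
              orderG c k + 2 * (h * suc h) ≤ 2 * (s * s) + 2 * s
  bound-r≡h {s} {q} 1≤h refl regular = begin
    c * (c * k) + 2 * (h * suc h)   ≤⟨ +-monoˡ-≤ _ (*-monoʳ-≤ c (*-monoʳ-≤ c k≤K)) ⟩
    c * (c * K) + 2 * (h * suc h)   ≡⟨ total h q ⟩
    2 * (s * s) + 2 * s             ∎
    where
    open ≤-Reasoning
    K : ℕ
    K = q * 2 * suc q
    count-shape : ∀ h q → let s = h + q * suc (h * 2) in
                  q * suc (2 * s) + s ≡ suc (h * 2) * (q * 2 * suc q) + h
    count-shape = ℕ-Solver.solve-∀
    ck≤cK+h : c * k ≤ c * K + h
    ck≤cK+h = subst (c * k ≤_) (count-shape h q)
                (count-h≤r<2h {t = 0} {q} 1≤h (cong (_+ q * c) (sym (+-identityʳ h))) regular)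
    k≤K : k ≤ K
    k≤K = m*n≤m*o+p∧p<m⇒n≤o ck≤cK+h (s≤s (m≤m*n h 2))
    total : ∀ h q → let s = h + q * suc (h * 2) in
            suc (h * 2) * (suc (h * 2) * (q * 2 * suc q)) + 2 * (h * suc h) ≡ 2 * (s * s) + 2 * s
    total = ℕ-Solver.solve-∀

  bound-r≡2h : ∀ {s q} → s ≡ h * 2 + q * c → SRegular c k s →
               orderG c k + h * 2 * s ≤ 2 * (s * s) + 2 * s + 1
  bound-r≡2h {s} {q} refl regular = begin
    c * (c * k) + h * 2 * s                      ≤⟨ +-monoˡ-≤ _ (*-monoʳ-≤ c ck≤q[1+2s]+1+s) ⟩
    c * (q * suc (2 * s) + suc s) + h * 2 * s    ≡⟨ total h q ⟩
    2 * (s * s) + 2 * s + 1                      ∎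
    where
    open ≤-Reasoning
    span : ∀ h q → suc (2 * (h * 2 + q * suc (h * 2))) ≡ h * 2 + suc (q * 2) * suc (h * 2)
    span = ℕ-Solver.solve-∀
    ck≤q[1+2s]+1+s : c * k ≤ q * suc (2 * s) + suc s
    ck≤q[1+2s]+1+s = ≤-trans (count-1+2q regular (h * 2) q (n<1+n (h * 2)) (≤-reflexive (span h q)))
                    (≤-reflexive (cong (_+_ (q * suc (2 * s))) (sameParityCount-even s (h * 2) (m*n%n≡0 h 2))))
    total : ∀ h q → let s = h * 2 + q * suc (h * 2) in
            suc (h * 2) * (q * suc (2 * s) + suc s) + h * 2 * s ≡ 2 * (s * s) + 2 * s + 1
    total = ℕ-Solver.solve-∀

  <-0<r<h : ∀ {s t q} → 1 ≤ t → t < h → s ≡ t + q * c → SRegular c k s → orderG c k < 2 * (s * s)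
  <-0<r<h {s} {t} {q} 1≤t t<h s≡ regular = m+o≤n+p∧p<o⇒m<n (bound-r<h {q = q} t<h s≡ regular)
    (<-≤-trans (s≤s (m≤m+n s (s + 0))) (m≤n*m (suc (2 * s)) t {{>-nonZero 1≤t}}))

  <-h<r<2h : ∀ {s t q} → 1 ≤ t → t < h → s ≡ h + t + q * c → SRegular c k s → orderG c k < 2 * (s * s)
  <-h<r<2h {s} {t} {q} 1≤t t<h s≡ regular =
    m+o≤n+p∧p<o⇒m<n (bound-h≤r<2h {q = q} t<h s≡ regular) (begin-strict
    2 * s                  ≤⟨ *-monoˡ-≤ s (*-monoʳ-≤ 2 1≤t) ⟩
    2 * t * s              <⟨ m<m+n (2 * t * s) (≤-trans 1≤t (m≤n+m t h)) ⟩
    2 * t * s + (h + t)    ∎)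
    where open ≤-Reasoning

  <-r≡2h : ∀ {s q} → 2 ≤ h → 1 ≤ s → s ≡ h * 2 + q * c → SRegular c k s → orderG c k < 2 * (s * s)
  <-r≡2h {s} {q} 2≤h 1≤s s≡ regular = m+o≤n+p∧p<o⇒m<n
    (≤-trans (bound-r≡2h {q = q} s≡ regular) (≤-reflexive (+-assoc (2 * (s * s)) (2 * s) 1))) (begin-strict
    2 * s + 1          <⟨ +-monoʳ-< (2 * s) (*-monoʳ-≤ 2 1≤s) ⟩
    2 * s + 2 * s      ≡⟨ double s ⟩
    2 * 2 * s          ≤⟨ *-monoˡ-≤ s (*-monoˡ-≤ 2 2≤h) ⟩
    h * 2 * s          ∎)
    where
    open ≤-Reasoning
    double : ∀ s → 2 * s + 2 * s ≡ 2 * 2 * s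
    double = ℕ-Solver.solve-∀

  orderG<2s² : ∀ {s} → 1 ≤ h → 1 ≤ s → s % c ≢ 0 → s % c ≢ h → ¬ (h ≡ 1 × s % c ≡ 2) →
               SRegular c k s → orderG c k < 2 * (s * s)
  orderG<2s² {s} 1≤h 1≤s r≢0 r≢h ¬[h≡1×r≡2] regular = by-residue (<-cmp r h)
    where
    r q : ℕ
    r = s % c
    q = s / c

    s≡r+qc : s ≡ r + q * c
    s≡r+qc = m≡m%n+[m/n]*n s c

    h+h≡h*2 : h + h ≡ h * 2
    h+h≡h*2 = trans (cong (_+_ h) (sym (+-identityʳ h))) (*-comm 2 h)

    above-centre : ∀ t → r ≡ h + t → 1 ≤ t → t ≤ h → orderG c k < 2 * (s * s)
    above-centre t r≡h+t 1≤t t≤h with m≤n⇒m<n∨m≡n t≤h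
    ... | inj₁ t<h = <-h<r<2h {q = q} 1≤t t<h (trans s≡r+qc (cong (_+ q * c) r≡h+t)) regular
    ... | inj₂ refl with m≤n⇒m<n∨m≡n 1≤h
    ...   | inj₁ 2≤h = <-r≡2h {q = q} 2≤h 1≤s (trans s≡r+qc (cong (_+ q * c) (trans r≡h+t h+h≡h*2))) regular
    ...   | inj₂ 1≡h = contradiction (sym 1≡h , trans r≡h+t (cong₂ _+_ (sym 1≡h) (sym 1≡h))) ¬[h≡1×r≡2]

    by-residue : Tri (r < h) (r ≡ h) (h < r) → orderG c k < 2 * (s * s)
    by-residue (tri< r<h _ _) = <-0<r<h {q = q} (n≢0⇒n>0 r≢0) r<h s≡r+qc regular
    by-residue (tri≈ _ r≡h _) = contradiction r≡h r≢h
    by-residue (tri> _ _ h<r) = above-centre (r ∸ h) (sym (m+[n∸m]≡n (<⇒≤ h<r))) (m<n⇒0<n∸m h<r)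
      (+-cancelˡ-≤ h (r ∸ h) h (begin
        h + (r ∸ h)   ≡⟨ m+[n∸m]≡n (<⇒≤ h<r) ⟩
        r             ≤⟨ s≤s⁻¹ (m%n<n s c) ⟩
        h * 2         ≡⟨ h+h≡h*2 ⟨
        h + h         ∎))
      where open ≤-Reasoning

¬2∣⇒≡1+h*2 : ∀ {c} → ¬ 2 ∣ c → 2 ≤ c → Σ ℕ λ h → 1 ≤ h × c ≡ suc (h * 2)
¬2∣⇒≡1+h*2 {c} ¬2∣c 2≤c = c / 2 , m≥n⇒m/n>0 2≤c , trans (m≡m%n+[m/n]*n c 2) (cong (_+ c / 2 * 2) c%2≡1)
  where
  c%2≡1 : c % 2 ≡ 1
  c%2≡1 = [ (λ c%2≡0 → contradiction (m%n≡0⇒n∣m c 2 c%2≡0) ¬2∣c) , id ]′ (%2≡0⊎%2≡1 c)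

evenModulus-bound : ∀ {c k s} → 2 ∣ c → 2 ≤ c → SRegular c k s → orderG c k ≤ 2 * (s * s)
evenModulus-bound {k = k} {s} (divides (suc m) refl) _ regular = EvenModulus.bound m k s regular

evenModulus-extremal : ∀ {c k s} → 2 ∣ c → 2 ≤ c → 1 ≤ s → SRegular c k s →
                       orderG c k ≡ 2 * (s * s) → s ≡ℕ 0 [mod c ]
evenModulus-extremal {k = k} {s} (divides (suc m) refl) _ 1≤s regular = EvenModulus.extremal m k s regular 1≤s

oddModulus-s≡0 : ∀ {c k s} → ¬ 2 ∣ c → 2 ≤ c → SRegular c k s → s ≡ℕ 0 [mod c ] →
                 orderG c k ≤ 2 * (s * s) + s
oddModulus-s≡0 {c} {k} {s} ¬2∣c 2≤c regular s≡0 with ¬2∣⇒≡1+h*2 ¬2∣c 2≤c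
... | h , 1≤h , refl = ≤-trans (m≤m+n (orderG c k) 0)
  (OddModulus.bound-r<h h k {q = s / c} 1≤h (m%n≡r⇒m≡r+[m/n]*n (≡[mod]⇒%≡ {m = s} {0} s≡0)) regular)

oddModulus-s≡half : ∀ {c k s} → ¬ 2 ∣ c → 2 ≤ c → SRegular c k s → s ≡ℕ ((c ∸ 1) / 2) [mod c ] →
                    orderG c k + ((c * c ∸ 1) / 2) ≤ 2 * (s * s) + 2 * s
oddModulus-s≡half {c} {k} {s} ¬2∣c 2≤c regular s≡half with ¬2∣⇒≡1+h*2 ¬2∣c 2≤c
... | h , 1≤h , refl = subst (λ d → orderG c k + d ≤ 2 * (s * s) + 2 * s) (sym [c²-1]/2≡2h[h+1])
  (OddModulus.bound-r≡h h k {q = s / c} 1≤h (m%n≡r⇒m≡r+[m/n]*n s%c≡h) regular)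
  where
  s%c≡h : s % c ≡ h
  s%c≡h = ≡[mod]∧<⇒%≡ (s≤s (m≤m*n h 2)) (subst (λ r → s ≡ℕ r [mod c ]) (m*n/n≡m h 2) s≡half)

  [c²-1]/2≡2h[h+1] : (c * c ∸ 1) / 2 ≡ 2 * (h * suc h)
  [c²-1]/2≡2h[h+1] = trans (cong (_/ 2) (shape h)) (m*n/n≡m (2 * (h * suc h)) 2)
    where
    shape : ∀ h → h * 2 + h * 2 * suc (h * 2) ≡ 2 * (h * suc h) * 2
    shape = ℕ-Solver.solve-∀

modulus3-s≡2 : ∀ {c k s} → c ≡ 3 → SRegular c k s → s ≡ℕ 2 [mod 3 ] → orderG c k ≤ 2 * (s * s) + 1
modulus3-s≡2 {k = k} {s} refl regular s≡2 = +-cancelʳ-≤ (2 * s) (orderG 3 k) (2 * (s * s) + 1)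
  (≤-trans (OddModulus.bound-r≡2h 1 k {q = s / 3} (m%n≡r⇒m≡r+[m/n]*n (≡[mod]∧<⇒%≡ {m = s} (n<1+n 2) s≡2)) regular)
           (≤-reflexive (swap (2 * (s * s)) (2 * s))))
  where
  swap : ∀ a b → a + b + 1 ≡ a + 1 + b
  swap = ℕ-Solver.solve-∀

oddModulus-generic : ∀ {c k s} → ¬ 2 ∣ c → 2 ≤ c → 1 ≤ s → SRegular c k s →
                     ¬ (s ≡ℕ 0 [mod c ]) → ¬ (s ≡ℕ ((c ∸ 1) / 2) [mod c ]) → ¬ ((c ≡ 3) × (s ≡ℕ 2 [mod 3 ])) →
                     orderG c k < 2 * (s * s)
oddModulus-generic {c} {k} {s} ¬2∣c 2≤c 1≤s regular s≢0 s≢half ¬[c≡3×s≡2] with ¬2∣⇒≡1+h*2 ¬2∣c 2≤c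
... | h , 1≤h , refl = OddModulus.orderG<2s² h k 1≤h 1≤s (s≢0 ∘ %≡⇒≡[mod] {m = s} {0}) (s≢half ∘ s%c≡h⇒s≡half)
  (λ (h≡1 , s%c≡2) → ¬[c≡3×s≡2] (cong (λ h → suc (h * 2)) h≡1 ,
                                 %≡∧<⇒≡[mod] {m = s} (n<1+n 2) (subst (λ h → s % suc (h * 2) ≡ 2) h≡1 s%c≡2)))
  regular
  where
  s%c≡h⇒s≡half : s % c ≡ h → s ≡ℕ ((c ∸ 1) / 2) [mod c ]
  s%c≡h⇒s≡half s%c≡h = subst (λ r → s ≡ℕ r [mod c ]) (sym (m*n/n≡m h 2))
                         (%≡∧<⇒≡[mod] {m = s} (s≤s (m≤m*n h 2)) s%c≡h)

mainTheorem9 : (c k s : ℕ) → 2 ≤ c → 1 ≤ k → 1 ≤ s → SRegular c k s →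
    ((2 ∣ c) →
      (orderG c k ≤ 2 * (s * s))
      × (orderG c k ≡ 2 * (s * s) → s ≡ℕ 0 [mod c ]))
    × ((¬ (2 ∣ c)) →
      ((s ≡ℕ 0 [mod c ]) → orderG c k ≤ 2 * (s * s) + s)
      × ((s ≡ℕ ((c ∸ 1) / 2) [mod c ]) →
          orderG c k + ((c * c ∸ 1) / 2) ≤ 2 * (s * s) + 2 * s)
      × ((c ≡ 3) → (s ≡ℕ 2 [mod 3 ]) → orderG c k ≤ 2 * (s * s) + 1)
      × (¬ (s ≡ℕ 0 [mod c ]) → ¬ (s ≡ℕ ((c ∸ 1) / 2) [mod c ]) →
          ¬ ((c ≡ 3) × (s ≡ℕ 2 [mod 3 ])) →
          orderG c k < 2 * (s * s)))
mainTheorem9 c k s 2≤c _ 1≤s regular =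
  (λ 2∣c → evenModulus-bound 2∣c 2≤c regular , evenModulus-extremal 2∣c 2≤c 1≤s regular) ,
  (λ ¬2∣c → oddModulus-s≡0 ¬2∣c 2≤c regular ,
            oddModulus-s≡half ¬2∣c 2≤c regular ,
            (λ c≡3 → modulus3-s≡2 c≡3 regular) ,
            oddModulus-generic ¬2∣c 2≤c 1≤s regular)
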